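{- Let $\Delta$ be a shellable simplicial complex on $[n]$ with $\dim\Delta\le n-3$, with shelling $F_1,\dots,F_q$, and let $F=F_q$ be the last facet. Then the complex $\Delta_F$ is shellable. Moreover, $\Delta_F$ admits a shelling such that for every facet $\widetilde F_i=(F_i\cap F)\cup\{v\}$ of $\Delta_F$ of type (B), one has $\widetilde G_i=G_i\cap F$, where $\widetilde G_i$ is computed with respect to this shelling of $\Delta_F$ and $G_i$ with respect to the shelling $F_1,\dots,F_q$ of $\Delta$.
   Context: For a face $\sigma$ of $\Delta$, $\Delta_\sigma$ is the simplicial complex on vertex set $\sigma\cup\{v\}$ ($v$ a new vertex) whose facets are: (A) the sets $F'\cap\sigma$ maximal under inclusion in $\{F'\cap\sigma:F'\text{ a facet of }\Delta,\ \sigma\not\subseteq F',\ F'\cup\sigma\ne[n]\}$ (facets of type (A)); and (B) the sets $(F'\cap\sigma)\cup\{v\}$ for facets $F'$ of $\Delta$ with $F'\cup\sigma=[n]$ (facets of type (B)). A shelling is a linear order $F_1,\dots,F_q$ of the facets such that for each $k\ge2$, $\big(\bigcup_{i<k}2^{F_i}\big)\cap2^{F_k}$ is pure of dimension $\dim F_k-1$. For a shelling, $G_1=F_1$ and for $i\ge2$, $G_i$ is the intersection of all walls (codimension-one faces) of $F_i$ lying in the subcomplex generated by $F_1,\dots,F_{i-1}$. -}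

module Defs where

open import Data.Nat using (ℕ; zero; suc; _+_; _<_; _≤_)
open import Data.Fin using (Fin; toℕ; fromℕ)
open import Data.Fin.Subset using (Subset; _∈_; _⊆_; _∩_; _∪_; ⊤; ∣_∣; inside; outside)
open import Data.Vec using (_∷_)
open import Data.Product using (Σ; ∃; ∃-syntax; _×_; _,_)
open import Data.Sum using (_⊎_)
open import Relation.Nullary using (¬_)
open import Relation.Binary.PropositionalEquality using (_≡_; _≢_)

-- Faces are subsets of the vertex set Fin m.  A (finite) sequence of
-- facets is a function  F : Fin q → Subset m  (F i is the (i+1)-st facet).

-- The facets F form an antichain (distinct facets, none contained in another):
-- then they are exactly the facets of the complex they generate.
IsFacetFamily : ∀ {m} (q : ℕ) → (Fin q → Subset m) → Set
IsFacetFamily q F = ∀ i j → F i ⊆ F j → i ≡ j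

InEarlier : ∀ {m q} → (Fin q → Subset m) → Fin q → Subset m → Set
InEarlier F k τ = ∃[ j ] (toℕ j < toℕ k × τ ⊆ F j)

InInter : ∀ {m q} → (Fin q → Subset m) → Fin q → Subset m → Set
InInter F k τ = InEarlier F k τ × τ ⊆ F k

-- Shelling order: for every k ≥ 2 (0-based index k ≥ 1) the complex
-- ⟨F_j : j < k⟩ ∩ 2^{F_k} is pure of dimension dim F_k - 1, i.e. each of
-- its facets (maximal faces) τ has  ∣τ∣ = ∣F_k∣ - 1.
IsShelling : ∀ {m} (q : ℕ) → (Fin q → Subset m) → Set
IsShelling q F =
  ∀ k → 0 < toℕ k →
    ∀ τ → InInter F k τ →
      (∀ ρ → InInter F k ρ → τ ⊆ ρ → ρ ⊆ τ) →
      ∣ τ ∣ + 1 ≡ ∣ F k ∣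

IsWall : ∀ {m} → Subset m → Subset m → Set
IsWall Fk W = W ⊆ Fk × ∣ W ∣ + 1 ≡ ∣ Fk ∣

-- IsG F k G : G is the intersection of all walls of F_k lying in the
-- subcomplex generated by F_1,…,F_{k-1} (the empty intersection being F_k,
-- so that in particular G_1 = F_1).
IsG : ∀ {m q} → (Fin q → Subset m) → Fin q → Subset m → Set
IsG {m} F k G =
  ∀ (x : Fin m) →
    (x ∈ G → x ∈ F k × (∀ W → IsWall (F k) W → InEarlier F k W → x ∈ W)) ×
    (x ∈ F k → (∀ W → IsWall (F k) W → InEarlier F k W → x ∈ W) → x ∈ G)

-- The complex Δ_σ.  Vertex set: Fin (suc n), where the new vertex v is
-- `zero` and an old vertex x is `suc x`; so a face is  b ∷ S  with
-- S ⊆ [n] and b = inside iff v belongs to the face.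

IsACand : ∀ {n q} → (Fin q → Subset n) → Subset n → Subset n → Set
IsACand F σ S = ∃[ i ] (¬ (σ ⊆ F i) × F i ∪ σ ≢ ⊤ × S ≡ F i ∩ σ)

IsTypeA : ∀ {n q} → (Fin q → Subset n) → Subset n → Subset (suc n) → Set
IsTypeA F σ T =
  ∃[ S ] (T ≡ outside ∷ S × IsACand F σ S ×
          (∀ S' → IsACand F σ S' → S ⊆ S' → S' ⊆ S))

IsTypeB : ∀ {n q} → (Fin q → Subset n) → Subset n → Subset (suc n) → Set
IsTypeB F σ T = ∃[ i ] (F i ∪ σ ≡ ⊤ × T ≡ inside ∷ (F i ∩ σ))

IsFacetΔσ : ∀ {n q} → (Fin q → Subset n) → Subset n → Subset (suc n) → Set
IsFacetΔσ F σ T =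
  (IsTypeA F σ T ⊎ IsTypeB F σ T) ×
  (∀ T' → (IsTypeA F σ T' ⊎ IsTypeB F σ T') → T ⊆ T' → T' ⊆ T)

EnumeratesFacetsΔσ : ∀ {n q} → (Fin q → Subset n) → Subset n →
                     (p : ℕ) → (Fin p → Subset (suc n)) → Set
EnumeratesFacetsΔσ F σ p H =
  (∀ j → IsFacetΔσ F σ (H j)) ×
  (∀ T → IsFacetΔσ F σ T → ∃[ j ] H j ≡ T) ×
  (∀ j j' → H j ≡ H j' → j ≡ j')

-- Order the facets of Δ_σ (σ = F_q) as all facets of type (A) first, then those of type (B),
-- (F_i ∩ σ) ∪ {v}, in the order of the shelling of Δ.  Every F_i ∩ σ with i < q lies in a wall
-- σ - x of σ belonging to ⟨F_1, …, F_{q-1}⟩ (shelling condition at F_q), so the type (A) facets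
-- are exactly these walls, and distinct walls of one face form a shelling in any order.  For a
-- type (B) facet B_i, a face of an earlier facet either avoids v and lies in the wall F_i ∩ σ
-- (itself inside a type (A) facet), or lies in some B_i′ with i′ < i; then the shelling of Δ at
-- F_i puts F_i ∩ F_i′ in an earlier wall F_i - y, where y ∈ σ because F_i′ ∪ σ = [n], and
-- (F_i ∩ σ - y) ∪ {v} is an earlier wall of B_i.  Conversely the earlier walls of B_i through v
-- are exactly these, which gives G̃_i = G_i ∩ σ; v ∉ G̃_i since F_i ∩ σ is always an earlier wall.
-- The bound ∣F_i∣ ≤ n - 2 prevents F_i ⊇ [n] - x, so facets of type (A) and (B) never nest.
module Submission where

open import Defs
open import Data.Nat using (ℕ; zero; suc; _+_; _≤_; _<_; z≤n; s≤s)
import Data.Nat.Properties as ℕ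
open import Data.Fin using (Fin; zero; suc; toℕ; fromℕ; splitAt; _↑ˡ_; _↑ʳ_)
  renaming (_<_ to _<ᶠ_)
open import Data.Fin.Properties
  using (_≟_; any?; ≤fromℕ; suc-injective; toℕ<n; toℕ-injective; toℕ-↑ˡ; toℕ-↑ʳ;
         splitAt⁻¹-↑ˡ; splitAt⁻¹-↑ʳ)
open import Data.Fin.Subset
  using (Subset; _∈_; _∉_; _⊆_; _⊈_; _⊂_; _⊃_; _∩_; _∪_; _─_; _-_; ⊤; ⁅_⁆; ∣_∣; inside; outside)
open import Data.Fin.Subset.Properties
  using (_∈?_; _⊆?_; _⊂?_; ⊆-refl; ⊆-reflexive; ⊆-trans; ⊆-antisym; s⊆s; drop-∷-⊆; drop-there;
         ∈⊤; ⊆⊤; ∣⊤∣≡n; p⊆q⇒∣p∣≤∣q∣; p⊂q⇒∣p∣<∣q∣; p─⊥≡p; x∈⁅x⁆; x≢y⇒x∉⁅y⁆;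
         x∈p∩q⁺; x∈p∩q⁻; p∩q⊆p; p∩q⊆q; x∈p∪q⁺; x∈p∪q⁻; anySubset?)
open import Data.Fin.Subset.Induction using (⊃-wellFounded)
import Data.Bool as Bool
open import Data.Vec using (_∷_; here; there)
open import Data.Vec.Properties using (≡-dec; ∷-injectiveʳ)
open import Data.Vec.Functional using (_++_)
open import Data.Vec.Functional.Properties using (lookup-++ˡ; lookup-++ʳ)
open import Data.Product using (Σ; ∃; ∃-syntax; _×_; _,_; proj₁; proj₂)
open import Data.Sum using (_⊎_; inj₁; inj₂)
open import Data.Empty using (⊥-elim)
open import Function using (id; _∘_; _⇔_; mk⇔; Equivalence)
open import Induction.WellFounded using (Acc; acc)
open import Level using (0ℓ)
open import Relation.Nullary using (¬_; yes; no; contradiction)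
open import Relation.Nullary.Decidable using (_×-dec_; ¬?)
open import Relation.Unary using (Pred; Decidable)
open import Relation.Binary.Definitions using (tri<; tri≈; tri>)
open import Relation.Binary.PropositionalEquality
  using (_≡_; _≢_; refl; sym; trans; cong; subst)

open Equivalence using (to; from)

private
  variable
    m : ℕ
    p q τ : Subset m
    x y : Fin m

x∈p─q⁻ : ∀ (p q : Subset m) → x ∈ p ─ q → x ∈ p × x ∉ q
x∈p─q⁻ (inside ∷ p) (outside ∷ q) here = here , λ ()
x∈p─q⁻ {x = zero} (outside ∷ p) (inside ∷ q) ()
x∈p─q⁻ {x = zero} (outside ∷ p) (outside ∷ q) ()
x∈p─q⁻ (s ∷ p) (t ∷ q) (there x∈p─q) with x∈p─q⁻ p q x∈p─q
... | x∈p , x∉q = there x∈p , λ { (there x∈q) → x∉q x∈q }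

x∈p─q⁺ : x ∈ p → x ∉ q → x ∈ p ─ q
x∈p─q⁺ {q = inside ∷ q} here x∉q = contradiction here x∉q
x∈p─q⁺ {q = outside ∷ q} here x∉q = here
x∈p─q⁺ {q = t ∷ q} (there x∈p) x∉q = there (x∈p─q⁺ x∈p (x∉q ∘ there))

x∈p-y⁻ : x ∈ p - y → x ∈ p × x ≢ y
x∈p-y⁻ {p = p} {y = y} x∈p-y with x∈p─q⁻ p ⁅ y ⁆ x∈p-y
... | x∈p , x∉⁅y⁆ = x∈p , λ { refl → x∉⁅y⁆ (x∈⁅x⁆ y) }

x∈p-y⁺ : x ∈ p → x ≢ y → x ∈ p - y
x∈p-y⁺ x∈p x≢y = x∈p─q⁺ x∈p (x≢y⇒x∉⁅y⁆ x≢y)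

p-x⊆p : p - x ⊆ p
p-x⊆p = proj₁ ∘ x∈p-y⁻

x∉p-x : x ∉ p - x
x∉p-x x∈p-x = proj₂ (x∈p-y⁻ x∈p-x) refl

∣p-x∣ : x ∈ p → suc ∣ p - x ∣ ≡ ∣ p ∣
∣p-x∣ {p = inside ∷ p} here = cong (suc ∘ ∣_∣) (p─⊥≡p p)
∣p-x∣ {p = inside ∷ p} (there x∈p) = cong suc (∣p-x∣ x∈p)
∣p-x∣ {p = outside ∷ p} (there x∈p) = ∣p-x∣ x∈p

s∷p-zero≡outside∷p : ∀ s (S : Subset m) → (s ∷ S) - zero ≡ outside ∷ S
s∷p-zero≡outside∷p s S = cong (outside ∷_) (p─⊥≡p S)

-injective : x ∈ p → p - x ≡ p - y → x ≡ y
-injective {x = x} {y = y} x∈p eq with x ≟ y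
... | yes x≡y = x≡y
... | no x≢y = contradiction (subst (x ∈_) (sym eq) (x∈p-y⁺ x∈p x≢y)) x∉p-x

-⊆∧∈⇒⊆ : τ - x ⊆ q → x ∈ q → τ ⊆ q
-⊆∧∈⇒⊆ {x = x} τ-x⊆q x∈q {y} y∈τ with y ≟ x
... | yes refl = x∈q
... | no y≢x = τ-x⊆q (x∈p-y⁺ y∈τ y≢x)

-⊆∧⊈⇒≡∩ : τ - x ⊆ q → τ ⊈ q → τ - x ≡ q ∩ τ
-⊆∧⊈⇒≡∩ {τ = τ} {x = x} {q = q} τ-x⊆q τ⊈q =
  ⊆-antisym (λ y∈τ-x → x∈p∩q⁺ (τ-x⊆q y∈τ-x , p-x⊆p y∈τ-x)) q∩τ⊆τ-x
  where
  q∩τ⊆τ-x : q ∩ τ ⊆ τ - x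
  q∩τ⊆τ-x {y} y∈q∩τ with x∈p∩q⁻ q τ y∈q∩τ | y ≟ x
  ... | y∈q , y∈τ | no y≢x = x∈p-y⁺ y∈τ y≢x
  ... | y∈q , _ | yes refl = ⊥-elim (τ⊈q (-⊆∧∈⇒⊆ τ-x⊆q y∈q))

⊈⇒∃∉ : p ⊈ q → ∃[ x ] (x ∈ p × x ∉ q)
⊈⇒∃∉ {p = p} {q = q} p⊈q with any? (λ x → (x ∈? p) ×-dec ¬? (x ∈? q))
... | yes witness = witness
... | no no-witness = ⊥-elim (p⊈q (λ {x} → p⊆q))
  where
  p⊆q : p ⊆ q
  p⊆q {x} x∈p with x ∈? q
  ... | yes x∈q = x∈q
  ... | no x∉q = contradiction (x , x∈p , x∉q) no-witness

⊆∧⊈⇒⊂ : p ⊆ q → q ⊈ p → p ⊂ q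
⊆∧⊈⇒⊂ p⊆q q⊈p = p⊆q , ⊈⇒∃∉ q⊈p

⊆∧∣≡∣⇒≡ : p ⊆ q → ∣ p ∣ ≡ ∣ q ∣ → p ≡ q
⊆∧∣≡∣⇒≡ {p = p} {q = q} p⊆q ∣p∣≡∣q∣ with q ⊆? p
... | yes q⊆p = ⊆-antisym p⊆q q⊆p
... | no q⊈p = contradiction ∣p∣≡∣q∣ (ℕ.<⇒≢ (p⊂q⇒∣p∣<∣q∣ (⊆∧⊈⇒⊂ p⊆q q⊈p)))

∪≡⊤⇒∉⇒∈ : p ∪ q ≡ ⊤ → x ∉ q → x ∈ p
∪≡⊤⇒∉⇒∈ {p = p} {q = q} {x = x} p∪q≡⊤ x∉q
  with x∈p∪q⁻ p q (subst (x ∈_) (sym p∪q≡⊤) ∈⊤)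
... | inj₁ x∈p = x∈p
... | inj₂ x∈q = contradiction x∈q x∉q

∪≡⊤⇒⊆ : p ∪ q ≡ ⊤ → (∀ {x} → x ∈ τ → x ∈ q → x ∈ p) → τ ⊆ p
∪≡⊤⇒⊆ {q = q} p∪q≡⊤ τ∩q⊆p {x} x∈τ with x ∈? q
... | yes x∈q = τ∩q⊆p x∈τ x∈q
... | no x∉q = ∪≡⊤⇒∉⇒∈ p∪q≡⊤ x∉q

∉⇒∈⇒∪≡⊤ : (∀ {x} → x ∉ q → x ∈ p) → p ∪ q ≡ ⊤
∉⇒∈⇒∪≡⊤ {q = q} {p = p} ∁q⊆p = ⊆-antisym ⊆⊤ ⊤⊆p∪q
  where
  ⊤⊆p∪q : ⊤ ⊆ p ∪ q
  ⊤⊆p∪q {x} _ with x ∈? q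
  ... | yes x∈q = x∈p∪q⁺ (inj₂ x∈q)
  ... | no x∉q = x∈p∪q⁺ (inj₁ (∁q⊆p x∉q))

⊤-x⊆p⇒m≤1+∣p∣ : ∀ {m} {x : Fin m} {p} → ⊤ - x ⊆ p → m ≤ suc ∣ p ∣
⊤-x⊆p⇒m≤1+∣p∣ {m} {x} {p} ⊤-x⊆p =
  subst (_≤ suc ∣ p ∣) (trans (∣p-x∣ {x = x} {p = ⊤} ∈⊤) (∣⊤∣≡n m)) (s≤s (p⊆q⇒∣p∣≤∣q∣ ⊤-x⊆p))

-wall : x ∈ τ → IsWall τ (τ - x)
-wall x∈τ = p-x⊆p , trans (ℕ.+-comm _ 1) (∣p-x∣ x∈τ)

wall⇒≡- : ∀ {W} → IsWall τ W → ∃[ x ] (x ∈ τ × W ≡ τ - x)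
wall⇒≡- {τ = τ} {W = W} (W⊆τ , ∣W∣+1≡∣τ∣) with τ ⊆? W
... | yes τ⊆W = contradiction (p⊆q⇒∣p∣≤∣q∣ τ⊆W) (ℕ.<⇒≱ ∣W∣<∣τ∣)
  where
  ∣W∣<∣τ∣ : ∣ W ∣ < ∣ τ ∣
  ∣W∣<∣τ∣ = subst (∣ W ∣ <_) ∣W∣+1≡∣τ∣ (ℕ.m<m+n ∣ W ∣ (s≤s z≤n))
... | no τ⊈W with ⊈⇒∃∉ τ⊈W
...   | x , x∈τ , x∉W = x , x∈τ , ⊆∧∣≡∣⇒≡ W⊆τ-x (ℕ.suc-injective ∣W∣+1≡∣τ-x∣+1)
  where
  W⊆τ-x : W ⊆ τ - x
  W⊆τ-x {y} y∈W = x∈p-y⁺ (W⊆τ y∈W) (λ { refl → x∉W y∈W })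
  ∣W∣+1≡∣τ-x∣+1 : suc ∣ W ∣ ≡ suc ∣ τ - x ∣
  ∣W∣+1≡∣τ-x∣+1 = trans (ℕ.+-comm 1 ∣ W ∣) (trans ∣W∣+1≡∣τ∣ (sym (∣p-x∣ x∈τ)))

Maximal : Pred (Subset m) 0ℓ → Subset m → Set
Maximal P τ = ∀ ρ → P ρ → τ ⊆ ρ → ρ ⊆ τ

module _ {P : Pred (Subset m) 0ℓ} (P? : Decidable P) where

  extendToMaximal : P τ → ∃[ μ ] (P μ × τ ⊆ μ × Maximal P μ)
  extendToMaximal = go (⊃-wellFounded _)
    where
    go : ∀ {σ} → Acc _⊃_ σ → P σ → ∃[ μ ] (P μ × σ ⊆ μ × Maximal P μ)
    go {σ} (acc larger) Pσ with anySubset? (λ ρ → P? ρ ×-dec σ ⊂? ρ)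
    ... | yes (ρ , Pρ , σ⊂ρ) with go (larger σ⊂ρ) Pρ
    ...   | μ , Pμ , ρ⊆μ , μ-max = μ , Pμ , ⊆-trans (proj₁ σ⊂ρ) ρ⊆μ , μ-max
    go {σ} (acc larger) Pσ | no nothing-larger = σ , Pσ , ⊆-refl , σ-max
      where
      σ-max : Maximal P σ
      σ-max ρ Pρ σ⊆ρ with ρ ⊆? σ
      ... | yes ρ⊆σ = ρ⊆σ
      ... | no ρ⊈σ = contradiction (ρ , Pρ , ⊆∧⊈⇒⊂ σ⊆ρ ρ⊈σ) nothing-larger

module _ {q : ℕ} (F : Fin q → Subset m) where

  InEarlier? : ∀ k → Decidable (InEarlier F k)
  InEarlier? k τ = any? (λ j → (toℕ j ℕ.<? toℕ k) ×-dec (τ ⊆? F j))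

  InInter? : ∀ k → Decidable (InInter F k)
  InInter? k τ = InEarlier? k τ ×-dec (τ ⊆? F k)

WallsCover : (Subset m → Set) → Subset m → Set
WallsCover K σ = ∀ τ → K τ → τ ⊆ σ → ∃[ W ] (IsWall σ W × K W × τ ⊆ W)

WallsCover-resp-⇔ : ∀ {K K′ : Subset m → Set} {σ} →
  (∀ {τ} → K′ τ ⇔ K τ) → WallsCover K σ → WallsCover K′ σ
WallsCover-resp-⇔ K′⇔K cover τ K′τ τ⊆σ with cover τ (to K′⇔K K′τ) τ⊆σ
... | W , wall , KW , τ⊆W = W , wall , from K′⇔K KW , τ⊆W

wallsCover⇒maximal-is-wall : ∀ {K : Subset m → Set} {σ} → WallsCover K σ →
  ∀ τ → K τ × τ ⊆ σ → Maximal (λ ρ → K ρ × ρ ⊆ σ) τ → ∣ τ ∣ + 1 ≡ ∣ σ ∣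
wallsCover⇒maximal-is-wall cover τ (Kτ , τ⊆σ) τ-max with cover τ Kτ τ⊆σ
... | W , (W⊆σ , ∣W∣+1≡∣σ∣) , KW , τ⊆W =
  subst (λ ρ → ∣ ρ ∣ + 1 ≡ _) (⊆-antisym (τ-max W (KW , W⊆σ) τ⊆W) τ⊆W) ∣W∣+1≡∣σ∣

module _ {q : ℕ} {F : Fin q → Subset m} where

  wallsCover⇒IsShelling : (∀ k → WallsCover (InEarlier F k) (F k)) → IsShelling q F
  wallsCover⇒IsShelling cover k _ = wallsCover⇒maximal-is-wall (cover k)

  IsShelling⇒wallsCover : IsShelling q F → ∀ k → WallsCover (InEarlier F k) (F k)
  IsShelling⇒wallsCover shelling k τ τ-early@(_ , j<k , _) τ⊆Fk
    with extendToMaximal (InInter? F k) (τ-early , τ⊆Fk)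
  ... | μ , μ-inter@(μ-early , μ⊆Fk) , τ⊆μ , μ-max =
    μ , (μ⊆Fk , shelling k (ℕ.≤-<-trans z≤n j<k) μ μ-inter μ-max) , μ-early , τ⊆μ

  IsG⇒∈⇔ : ∀ {k G} → IsG F k G → x ∈ G ⇔ (x ∈ F k × ¬ InEarlier F k (F k - x))
  IsG⇒∈⇔ {x = x} {k = k} {G = G} isG = mk⇔ forth back
    where
    forth : x ∈ G → x ∈ F k × ¬ InEarlier F k (F k - x)
    forth x∈G with proj₁ (isG x) x∈G
    ... | x∈Fk , x∈earlierWalls = x∈Fk , x∉p-x ∘ x∈earlierWalls _ (-wall x∈Fk)
    back : x ∈ F k × ¬ InEarlier F k (F k - x) → x ∈ G
    back (x∈Fk , not-early) = proj₂ (isG x) x∈Fk x∈earlierWalls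
      where
      x∈earlierWalls : ∀ W → IsWall (F k) W → InEarlier F k W → x ∈ W
      x∈earlierWalls W wall early with wall⇒≡- wall
      ... | z , _ , refl with x ≟ z
      ...   | yes refl = contradiction early not-early
      ...   | no x≢z = x∈p-y⁺ x∈Fk x≢z

wallsOf-wallsCover : ∀ {c} (σ : Subset m) {x : Fin c → Fin m} →
  (∀ a → x a ∈ σ) → (∀ {a b} → x a ≡ x b → a ≡ b) →
  ∀ k → WallsCover (InEarlier (λ a → σ - x a) k) (σ - x k)
wallsOf-wallsCover σ {x} x∈σ x-injective k τ (j , j<k , τ⊆σ-xj) τ⊆σ-xk =
  σ - x k - x j , -wall (x∈p-y⁺ (x∈σ j) xj≢xk) , (j , j<k , σ-xk-xj⊆σ-xj) , τ⊆σ-xk-xj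
  where
  xj≢xk : x j ≢ x k
  xj≢xk xj≡xk with x-injective xj≡xk
  ... | refl = ℕ.<-irrefl refl j<k
  σ-xk-xj⊆σ-xj : σ - x k - x j ⊆ σ - x j
  σ-xk-xj⊆σ-xj y∈ with x∈p-y⁻ y∈
  ... | y∈σ-xk , y≢xj = x∈p-y⁺ (p-x⊆p y∈σ-xk) y≢xj
  τ⊆σ-xk-xj : τ ⊆ σ - x k - x j
  τ⊆σ-xk-xj y∈τ = x∈p-y⁺ (τ⊆σ-xk y∈τ) (proj₂ (x∈p-y⁻ (τ⊆σ-xj y∈τ)))

data ++-View (a b : ℕ) : Fin (a + b) → Set where
  left  : ∀ i → ++-View a b (i ↑ˡ b)
  right : ∀ j → ++-View a b (a ↑ʳ j)

++-view : ∀ a b k → ++-View a b k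
++-view a b k with splitAt a k in eq
... | inj₁ i = subst (++-View a b) (splitAt⁻¹-↑ˡ eq) (left i)
... | inj₂ j = subst (++-View a b) (splitAt⁻¹-↑ʳ eq) (right j)

module _ {a b : ℕ} where

  ↑ˡ<↑ˡ⇔ : ∀ {i i′ : Fin a} → (i ↑ˡ b) <ᶠ (i′ ↑ˡ b) ⇔ i <ᶠ i′
  ↑ˡ<↑ˡ⇔ {i} {i′} rewrite toℕ-↑ˡ i b | toℕ-↑ˡ i′ b = mk⇔ id id

  ↑ʳ<↑ʳ⇔ : ∀ {j j′ : Fin b} → (a ↑ʳ j) <ᶠ (a ↑ʳ j′) ⇔ j <ᶠ j′
  ↑ʳ<↑ʳ⇔ {j} {j′} rewrite toℕ-↑ʳ a j | toℕ-↑ʳ a j′ =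
    mk⇔ (ℕ.+-cancelˡ-< a _ _) (ℕ.+-monoʳ-< a)

  ↑ˡ<↑ʳ : ∀ (i : Fin a) (j : Fin b) → (i ↑ˡ b) <ᶠ (a ↑ʳ j)
  ↑ˡ<↑ʳ i j rewrite toℕ-↑ˡ i b | toℕ-↑ʳ a j =
    ℕ.<-≤-trans (toℕ<n i) (ℕ.m≤m+n a (toℕ j))

  module _ (xs : Fin a → Subset m) (ys : Fin b → Subset m) where

    InEarlier-++ˡ : ∀ i → InEarlier (xs ++ ys) (i ↑ˡ b) τ ⇔ InEarlier xs i τ
    InEarlier-++ˡ {τ = τ} i = mk⇔ forth back
      where
      forth : InEarlier (xs ++ ys) (i ↑ˡ b) τ → InEarlier xs i τ
      forth (k , k<i , τ⊆) with ++-view a b k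
      ... | left i′ = i′ , to ↑ˡ<↑ˡ⇔ k<i , subst (τ ⊆_) (lookup-++ˡ xs ys i′) τ⊆
      ... | right j = contradiction k<i (ℕ.<-asym (↑ˡ<↑ʳ i j))
      back : InEarlier xs i τ → InEarlier (xs ++ ys) (i ↑ˡ b) τ
      back (i′ , i′<i , τ⊆) =
        i′ ↑ˡ b , from ↑ˡ<↑ˡ⇔ i′<i , subst (τ ⊆_) (sym (lookup-++ˡ xs ys i′)) τ⊆

    InEarlier-++ʳ : ∀ j →
      InEarlier (xs ++ ys) (a ↑ʳ j) τ ⇔ ((∃[ i ] τ ⊆ xs i) ⊎ InEarlier ys j τ)
    InEarlier-++ʳ {τ = τ} j = mk⇔ forth back
      where
      forth : InEarlier (xs ++ ys) (a ↑ʳ j) τ → (∃[ i ] τ ⊆ xs i) ⊎ InEarlier ys j τ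
      forth (k , k<j , τ⊆) with ++-view a b k
      ... | left i = inj₁ (i , subst (τ ⊆_) (lookup-++ˡ xs ys i) τ⊆)
      ... | right j′ = inj₂ (j′ , to ↑ʳ<↑ʳ⇔ k<j , subst (τ ⊆_) (lookup-++ʳ xs ys j′) τ⊆)
      back : (∃[ i ] τ ⊆ xs i) ⊎ InEarlier ys j τ → InEarlier (xs ++ ys) (a ↑ʳ j) τ
      back (inj₁ (i , τ⊆)) = i ↑ˡ b , ↑ˡ<↑ʳ i j , subst (τ ⊆_) (sym (lookup-++ˡ xs ys i)) τ⊆
      back (inj₂ (j′ , j′<j , τ⊆)) =
        a ↑ʳ j′ , from ↑ʳ<↑ʳ⇔ j′<j , subst (τ ⊆_) (sym (lookup-++ʳ xs ys j′)) τ⊆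

record Enumeration (P : Pred (Fin m) 0ℓ) : Set where
  field
    size : ℕ
    element : Fin size → Fin m
    element-mono : ∀ {a b} → a <ᶠ b → element a <ᶠ element b
    element-P : ∀ a → P (element a)
    element-surjective : ∀ {x} → P x → ∃[ a ] element a ≡ x

  element-injective : ∀ {a b} → element a ≡ element b → a ≡ b
  element-injective {a} {b} eq with ℕ.<-cmp (toℕ a) (toℕ b)
  ... | tri< a<b _ _ = contradiction (cong toℕ eq) (ℕ.<⇒≢ (element-mono a<b))
  ... | tri≈ _ a≡b _ = toℕ-injective a≡b
  ... | tri> _ _ b<a = contradiction (cong toℕ eq) (ℕ.>⇒≢ (element-mono b<a))

  element-cancel-< : ∀ {a b} → element a <ᶠ element b → a <ᶠ b
  element-cancel-< {a} {b} lt with ℕ.<-cmp (toℕ a) (toℕ b)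
  ... | tri< a<b _ _ = a<b
  ... | tri≈ _ a≡b _ = contradiction (cong (toℕ ∘ element) (toℕ-injective a≡b)) (ℕ.<⇒≢ lt)
  ... | tri> _ _ b<a = contradiction lt (ℕ.<-asym (element-mono b<a))

enumerate : {P : Pred (Fin m) 0ℓ} → Decidable P → Enumeration P
enumerate {zero} P? = record
  { size = 0 ; element = λ () ; element-mono = λ {} ; element-P = λ ()
  ; element-surjective = λ {} }
enumerate {suc m} {P} P? with enumerate (P? ∘ suc) | P? zero
... | E | yes P0 = record
  { size = suc size ; element = element′ ; element-mono = mono′ ; element-P = P′
  ; element-surjective = surjective′ }
  where
  open Enumeration E
  element′ : Fin (suc size) → Fin (suc m)
  element′ zero = zero
  element′ (suc a) = suc (element a)
  mono′ : ∀ {a b} → a <ᶠ b → element′ a <ᶠ element′ b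
  mono′ {zero} {suc b} _ = s≤s z≤n
  mono′ {suc a} {suc b} (s≤s a<b) = s≤s (element-mono a<b)
  P′ : ∀ a → P (element′ a)
  P′ zero = P0
  P′ (suc a) = element-P a
  surjective′ : ∀ {x} → P x → ∃[ a ] element′ a ≡ x
  surjective′ {zero} _ = zero , refl
  surjective′ {suc x} Px with element-surjective Px
  ... | a , refl = suc a , refl
... | E | no ¬P0 = record
  { size = size ; element = suc ∘ element ; element-mono = s≤s ∘ element-mono
  ; element-P = element-P ; element-surjective = surjective′ }
  where
  open Enumeration E
  surjective′ : ∀ {x} → P x → ∃[ a ] suc (element a) ≡ x
  surjective′ {zero} P0 = contradiction P0 ¬P0
  surjective′ {suc x} Px with element-surjective Px
  ... | a , refl = a , refl

module Δσ-Shelling {n p : ℕ} (F : Fin (suc p) → Subset n)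
  (facets : IsFacetFamily (suc p) F) (shelling : IsShelling (suc p) F)
  (small : ∀ i → ∣ F i ∣ + 2 ≤ n) where

  last : Fin (suc p)
  last = fromℕ p

  σ : Subset n
  σ = F last

  Cospanning : Pred (Fin (suc p)) 0ℓ
  Cospanning i = F i ∪ σ ≡ ⊤

  InRestriction : Pred (Fin n) 0ℓ
  InRestriction x = x ∈ σ × InEarlier F last (σ - x)

  ¬n≤1+∣F∣ : ∀ i → ¬ (n ≤ suc ∣ F i ∣)
  ¬n≤1+∣F∣ i n≤1+∣Fi∣ = ℕ.1+n≰n (begin
    2 + ∣ F i ∣ ≡⟨ ℕ.+-comm 2 ∣ F i ∣ ⟩
    ∣ F i ∣ + 2 ≤⟨ small i ⟩
    n           ≤⟨ n≤1+∣Fi∣ ⟩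
    1 + ∣ F i ∣ ∎)
    where open ℕ.≤-Reasoning

  ¬Cospanning-last : ¬ Cospanning last
  ¬Cospanning-last σ∪σ≡⊤ = ¬n≤1+∣F∣ last (ℕ.m≤n⇒m≤1+n n≤∣σ∣)
    where
    n≤∣σ∣ : n ≤ ∣ σ ∣
    n≤∣σ∣ = subst (_≤ ∣ σ ∣) (∣⊤∣≡n n) (p⊆q⇒∣p∣≤∣q∣ {p = ⊤} (∪≡⊤⇒⊆ σ∪σ≡⊤ (λ _ → id)))

  Cospanning⇒σ-x⊈F : ∀ {i x} → Cospanning i → σ - x ⊈ F i
  Cospanning⇒σ-x⊈F {i} {x} cospanning σ-x⊆Fi = ¬n≤1+∣F∣ i (⊤-x⊆p⇒m≤1+∣p∣ ⊤-x⊆Fi)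
    where
    ⊤-x⊆Fi : ⊤ - x ⊆ F i
    ⊤-x⊆Fi = ∪≡⊤⇒⊆ cospanning λ y∈⊤-x y∈σ → σ-x⊆Fi (x∈p-y⁺ y∈σ (proj₂ (x∈p-y⁻ y∈⊤-x)))

  Cospanning⇒∩σ-reflects-⊆ : ∀ {i i′} → Cospanning i′ → F i ∩ σ ⊆ F i′ ∩ σ → F i ⊆ F i′
  Cospanning⇒∩σ-reflects-⊆ cospanning ∩σ⊆ =
    ∪≡⊤⇒⊆ cospanning λ y∈Fi y∈σ → p∩q⊆p _ _ (∩σ⊆ (x∈p∩q⁺ (y∈Fi , y∈σ)))

  σ⊈F⇒<last : ∀ {i} → σ ⊈ F i → i <ᶠ last
  σ⊈F⇒<last {i} σ⊈Fi =
    ℕ.≤∧≢⇒< (≤fromℕ i) λ i≡last → σ⊈Fi (⊆-reflexive (cong F (sym (toℕ-injective i≡last))))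

  <last⇒σ⊈F : ∀ {i} → i <ᶠ last → σ ⊈ F i
  <last⇒σ⊈F i<last σ⊆Fi with facets last _ σ⊆Fi
  ... | refl = ℕ.<-irrefl refl i<last

  ∩σ⊆restrictionWall : ∀ {i} → i <ᶠ last → ∃[ x ] (InRestriction x × F i ∩ σ ⊆ σ - x)
  ∩σ⊆restrictionWall {i} i<last
    with IsShelling⇒wallsCover shelling last (F i ∩ σ) (i , i<last , p∩q⊆p _ _) (p∩q⊆q _ _)
  ... | W , wall , W-early , ∩σ⊆W with wall⇒≡- wall
  ...   | x , x∈σ , refl = x , (x∈σ , W-early) , ∩σ⊆W

  InRestriction⇒IsACand : ∀ {x} → InRestriction x → IsACand F σ (σ - x)
  InRestriction⇒IsACand (_ , j , j<last , σ-x⊆Fj) =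
    j , <last⇒σ⊈F j<last , (λ cospanning → Cospanning⇒σ-x⊈F cospanning σ-x⊆Fj) ,
    -⊆∧⊈⇒≡∩ σ-x⊆Fj (<last⇒σ⊈F j<last)

  IsACand-⊇wall⇒≡ : ∀ {x S} → IsACand F σ S → σ - x ⊆ S → S ≡ σ - x
  IsACand-⊇wall⇒≡ (i , σ⊈Fi , _ , refl) σ-x⊆Fi∩σ =
    sym (-⊆∧⊈⇒≡∩ (⊆-trans σ-x⊆Fi∩σ (p∩q⊆p _ _)) σ⊈Fi)

  facetA : Fin n → Subset (suc n)
  facetA x = outside ∷ (σ - x)

  facetB : Fin (suc p) → Subset (suc n)
  facetB i = inside ∷ (F i ∩ σ)

  TypeA⊎B : Pred (Subset (suc n)) 0ℓ
  TypeA⊎B T = IsTypeA F σ T ⊎ IsTypeB F σ T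

  facetA-maximal : ∀ {x} → InRestriction x → Maximal TypeA⊎B (facetA x)
  facetA-maximal _ _ (inj₁ (S , refl , candidate , _)) ⊆T =
    s⊆s (⊆-reflexive (IsACand-⊇wall⇒≡ candidate (drop-∷-⊆ ⊆T)))
  facetA-maximal _ _ (inj₂ (i , cospanning , refl)) ⊆T =
    ⊥-elim (Cospanning⇒σ-x⊈F cospanning (⊆-trans (drop-∷-⊆ ⊆T) (p∩q⊆p _ _)))

  facetB-maximal : ∀ {i} → Cospanning i → Maximal TypeA⊎B (facetB i)
  facetB-maximal _ _ (inj₁ (_ , refl , _)) ⊆T with ⊆T here
  ... | ()
  facetB-maximal {i} _ _ (inj₂ (i′ , cospanning′ , refl)) ⊆T
    with facets i i′ (Cospanning⇒∩σ-reflects-⊆ cospanning′ (drop-∷-⊆ ⊆T))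
  ... | refl = ⊆-refl

  IsFacetΔσ⇔ : ∀ {T} → IsFacetΔσ F σ T ⇔
    ((∃[ x ] (InRestriction x × T ≡ facetA x)) ⊎ (∃[ i ] (Cospanning i × T ≡ facetB i)))
  IsFacetΔσ⇔ = mk⇔ forth back
    where
    forth : ∀ {T} → IsFacetΔσ F σ T →
      (∃[ x ] (InRestriction x × T ≡ facetA x)) ⊎ (∃[ i ] (Cospanning i × T ≡ facetB i))
    forth (inj₁ (S , refl , (i , σ⊈Fi , _ , refl) , S-max) , _)
      with ∩σ⊆restrictionWall (σ⊈F⇒<last σ⊈Fi)
    ... | x , restr , S⊆σ-x =
      inj₁ (x , restr , cong (outside ∷_) S≡σ-x)
      where
      S≡σ-x : F i ∩ σ ≡ σ - x
      S≡σ-x = ⊆-antisym S⊆σ-x (S-max _ (InRestriction⇒IsACand restr) S⊆σ-x)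
    forth (inj₂ (i , cospanning , refl) , _) = inj₂ (i , cospanning , refl)
    back : ∀ {T} →
      (∃[ x ] (InRestriction x × T ≡ facetA x)) ⊎ (∃[ i ] (Cospanning i × T ≡ facetB i)) →
      IsFacetΔσ F σ T
    back (inj₁ (x , restr , refl)) =
      inj₁ (σ - x , refl , InRestriction⇒IsACand restr ,
            λ _ candidate ⊆S → ⊆-reflexive (IsACand-⊇wall⇒≡ candidate ⊆S)) ,
      facetA-maximal restr
    back (inj₂ (i , cospanning , refl)) = inj₂ (i , cospanning , refl) , facetB-maximal cospanning

  InRestriction? : Decidable InRestriction
  InRestriction? x = (x ∈? σ) ×-dec InEarlier? F last (σ - x)

  Cospanning? : Decidable Cospanning
  Cospanning? i = ≡-dec Bool._≟_ (F i ∪ σ) ⊤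

  module R = Enumeration (enumerate InRestriction?)
  module C = Enumeration (enumerate Cospanning?)

  H : Fin (R.size + C.size) → Subset (suc n)
  H = (facetA ∘ R.element) ++ (facetB ∘ C.element)

  H-↑ˡ : ∀ a → H (a ↑ˡ C.size) ≡ facetA (R.element a)
  H-↑ˡ = lookup-++ˡ (facetA ∘ R.element) (facetB ∘ C.element)

  H-↑ʳ : ∀ b → H (R.size ↑ʳ b) ≡ facetB (C.element b)
  H-↑ʳ = lookup-++ʳ (facetA ∘ R.element) (facetB ∘ C.element)

  H-facet : ∀ j → IsFacetΔσ F σ (H j)
  H-facet j with ++-view R.size C.size j
  ... | left a = from IsFacetΔσ⇔ (inj₁ (R.element a , R.element-P a , H-↑ˡ a))
  ... | right b = from IsFacetΔσ⇔ (inj₂ (C.element b , C.element-P b , H-↑ʳ b))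

  H-surjective : ∀ T → IsFacetΔσ F σ T → ∃[ j ] H j ≡ T
  H-surjective T facet with to IsFacetΔσ⇔ facet
  ... | inj₁ (x , restr , refl) with R.element-surjective restr
  ...   | a , refl = a ↑ˡ C.size , H-↑ˡ a
  H-surjective T facet | inj₂ (i , cospanning , refl) with C.element-surjective cospanning
  ...   | b , refl = R.size ↑ʳ b , H-↑ʳ b

  facetB-injective : ∀ {i i′} → Cospanning i → Cospanning i′ → facetB i ≡ facetB i′ → i ≡ i′
  facetB-injective cospanning cospanning′ eq =
    facets _ _ (Cospanning⇒∩σ-reflects-⊆ cospanning′ (⊆-reflexive (∷-injectiveʳ eq)))

  H-injective : ∀ j j′ → H j ≡ H j′ → j ≡ j′
  H-injective j j′ eq with ++-view R.size C.size j | ++-view R.size C.size j′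
  ... | left a | left a′ rewrite H-↑ˡ a | H-↑ˡ a′ =
    cong (_↑ˡ C.size) (R.element-injective (-injective (proj₁ (R.element-P a)) (∷-injectiveʳ eq)))
  ... | left a | right b′ rewrite H-↑ˡ a | H-↑ʳ b′ = contradiction eq λ ()
  ... | right b | left a′ rewrite H-↑ʳ b | H-↑ˡ a′ = contradiction eq λ ()
  ... | right b | right b′ rewrite H-↑ʳ b | H-↑ʳ b′ =
    cong (R.size ↑ʳ_) (C.element-injective (facetB-injective (C.element-P b) (C.element-P b′) eq))

  module _ (b : Fin C.size) where

    private
      i = C.element b
      k = R.size ↑ʳ b
      InEarlierH = InEarlier H k

    facetB-outerWall-early : InEarlierH (outside ∷ (F i ∩ σ))
    facetB-outerWall-early with ∩σ⊆restrictionWall (σ⊈F⇒<last σ⊈Fi)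
      where
      σ⊈Fi : σ ⊈ F i
      σ⊈Fi σ⊆Fi = ¬Cospanning-last (subst Cospanning (sym (facets last i σ⊆Fi)) (C.element-P b))
    ... | x , restr , ∩σ⊆σ-x with R.element-surjective restr
    ...   | a , refl = from (InEarlier-++ʳ _ _ b) (inj₁ (a , s⊆s ∩σ⊆σ-x))

    facetB-innerWall-early⇔ : y ∈ σ →
      InEarlierH (inside ∷ (F i ∩ σ - y)) ⇔ InEarlier F i (F i - y)
    facetB-innerWall-early⇔ {y = y} y∈σ = mk⇔ forth back
      where
      forth : InEarlierH (inside ∷ (F i ∩ σ - y)) → InEarlier F i (F i - y)
      forth early with to (InEarlier-++ʳ _ _ b) early
      ... | inj₁ (_ , ⊆facetA) with ⊆facetA here
      ...   | ()
      forth early | inj₂ (b′ , b′<b , ⊆facetB) =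
        C.element b′ , C.element-mono b′<b , ∪≡⊤⇒⊆ (C.element-P b′) Fi-y∩σ⊆
        where
        Fi-y∩σ⊆ : ∀ {z} → z ∈ F i - y → z ∈ σ → z ∈ F (C.element b′)
        Fi-y∩σ⊆ z∈Fi-y z∈σ with x∈p-y⁻ z∈Fi-y
        ... | z∈Fi , z≢y = p∩q⊆p _ _ (drop-∷-⊆ ⊆facetB (x∈p-y⁺ (x∈p∩q⁺ (z∈Fi , z∈σ)) z≢y))
      back : InEarlier F i (F i - y) → InEarlierH (inside ∷ (F i ∩ σ - y))
      back (k′ , k′<i , Fi-y⊆Fk′) with C.element-surjective (∉⇒∈⇒∪≡⊤ ∁σ⊆Fk′)
        where
        ∁σ⊆Fk′ : ∀ {z} → z ∉ σ → z ∈ F k′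
        ∁σ⊆Fk′ z∉σ =
          Fi-y⊆Fk′ (x∈p-y⁺ (∪≡⊤⇒∉⇒∈ (C.element-P b) z∉σ) (λ { refl → z∉σ y∈σ }))
      ... | b′ , refl =
        from (InEarlier-++ʳ _ _ b) (inj₂ (b′ , C.element-cancel-< k′<i , s⊆s ⊆Fk′∩σ))
        where
        ⊆Fk′∩σ : F i ∩ σ - y ⊆ F (C.element b′) ∩ σ
        ⊆Fk′∩σ z∈ with x∈p-y⁻ z∈
        ... | z∈Fi∩σ , z≢y with x∈p∩q⁻ _ _ z∈Fi∩σ
        ...   | z∈Fi , z∈σ = x∈p∩q⁺ (Fi-y⊆Fk′ (x∈p-y⁺ z∈Fi z≢y) , z∈σ)

    facetB-wallsCover : WallsCover InEarlierH (facetB i)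
    facetB-wallsCover τ early τ⊆facetB with to (InEarlier-++ʳ _ _ b) early
    ... | inj₁ (_ , τ⊆facetA) =
      outside ∷ (F i ∩ σ) ,
      subst (IsWall (facetB i)) (s∷p-zero≡outside∷p inside (F i ∩ σ)) (-wall here) ,
      facetB-outerWall-early , τ⊆outer
      where
      τ⊆outer : τ ⊆ outside ∷ (F i ∩ σ)
      τ⊆outer {zero} zero∈τ with τ⊆facetA zero∈τ
      ... | ()
      τ⊆outer {suc y} y∈τ = there (drop-there (τ⊆facetB y∈τ))
    ... | inj₂ (b′ , b′<b , τ⊆facetB′)
      with IsShelling⇒wallsCover shelling i (F i ∩ F i′)
             (i′ , C.element-mono b′<b , p∩q⊆q _ _) (p∩q⊆p _ _)
      where
      i′ = C.element b′
    ... | W , wall , W-early , Fi∩Fi′⊆W with wall⇒≡- wall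
    ...   | y , y∈Fi , refl with y ∈? σ
    ...     | no y∉σ =
      contradiction (Fi∩Fi′⊆W (x∈p∩q⁺ (y∈Fi , ∪≡⊤⇒∉⇒∈ (C.element-P b′) y∉σ))) x∉p-x
    ...     | yes y∈σ =
      inside ∷ (F i ∩ σ - y) , -wall (there (x∈p∩q⁺ (y∈Fi , y∈σ))) ,
      from (facetB-innerWall-early⇔ y∈σ) W-early , τ⊆inner
      where
      τ⊆inner : τ ⊆ inside ∷ (F i ∩ σ - y)
      τ⊆inner {zero} _ = here
      τ⊆inner {suc z} z∈τ
        with x∈p∩q⁻ _ _ (drop-there (τ⊆facetB z∈τ)) | x∈p∩q⁻ _ _ (drop-there (τ⊆facetB′ z∈τ))
      ... | z∈Fi , z∈σ | z∈Fi′ , _ =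
        there (x∈p-y⁺ (x∈p∩q⁺ (z∈Fi , z∈σ)) (proj₂ (x∈p-y⁻ (Fi∩Fi′⊆W (x∈p∩q⁺ (z∈Fi , z∈Fi′))))))

    IsG-facetB : ∀ {G̃ G} → IsG H k G̃ → IsG F i G → G̃ ≡ outside ∷ (G ∩ σ)
    IsG-facetB {G̃} {G} isG̃ isG = ⊆-antisym G̃⊆ ⊆G̃
      where
      ∈G̃⇔ : ∀ {x} → x ∈ G̃ ⇔ (x ∈ facetB i × ¬ InEarlierH (facetB i - x))
      ∈G̃⇔ {x} = subst (λ T → x ∈ G̃ ⇔ (x ∈ T × ¬ InEarlierH (T - x))) (H-↑ʳ b) (IsG⇒∈⇔ isG̃)
      G̃⊆ : G̃ ⊆ outside ∷ (G ∩ σ)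
      G̃⊆ {zero} zero∈G̃ = ⊥-elim (proj₂ (to ∈G̃⇔ zero∈G̃)
        (subst InEarlierH (sym (s∷p-zero≡outside∷p inside (F i ∩ σ))) facetB-outerWall-early))
      G̃⊆ {suc y} y∈G̃ with to ∈G̃⇔ y∈G̃
      ... | there y∈Fi∩σ , not-early with x∈p∩q⁻ _ _ y∈Fi∩σ
      ...   | y∈Fi , y∈σ = there (x∈p∩q⁺ (y∈G , y∈σ))
        where
        y∈G : y ∈ G
        y∈G = from (IsG⇒∈⇔ isG) (y∈Fi , not-early ∘ from (facetB-innerWall-early⇔ y∈σ))
      ⊆G̃ : outside ∷ (G ∩ σ) ⊆ G̃
      ⊆G̃ {suc y} (there y∈G∩σ) with x∈p∩q⁻ _ _ y∈G∩σ
      ... | y∈G , y∈σ with to (IsG⇒∈⇔ isG) y∈G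
      ...   | y∈Fi , not-early = from ∈G̃⇔
        (there (x∈p∩q⁺ (y∈Fi , y∈σ)) , not-early ∘ to (facetB-innerWall-early⇔ y∈σ))

  H-shelling : IsShelling (R.size + C.size) H
  H-shelling = wallsCover⇒IsShelling cover
    where
    cover : ∀ j → WallsCover (InEarlier H j) (H j)
    cover j with ++-view R.size C.size j
    ... | left a rewrite H-↑ˡ a =
      WallsCover-resp-⇔ (InEarlier-++ˡ _ _ a)
        (wallsOf-wallsCover (outside ∷ σ) (there ∘ proj₁ ∘ R.element-P)
           (R.element-injective ∘ suc-injective) a)
    ... | right b rewrite H-↑ʳ b = facetB-wallsCover b

  IsG-Cospanning : ∀ i j → Cospanning i → H j ≡ facetB i →
    ∀ G̃ G → IsG H j G̃ → IsG F i G → G̃ ≡ outside ∷ (G ∩ σ)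
  IsG-Cospanning i j cospanning Hj≡facetB G̃ G isG̃ isG with ++-view R.size C.size j
  ... | left a rewrite H-↑ˡ a = contradiction Hj≡facetB λ ()
  ... | right b with facetB-injective (C.element-P b) cospanning (trans (sym (H-↑ʳ b)) Hj≡facetB)
  ...   | refl = IsG-facetB b isG̃ isG

lemma4p8 : ∀ (n p : ℕ) (F : Fin (suc p) → Subset n) →
    IsFacetFamily (suc p) F →
    IsShelling (suc p) F →
    (∀ i → ∣ F i ∣ + 2 ≤ n) →
    ∃[ r ] Σ (Fin r → Subset (suc n)) λ H →
      EnumeratesFacetsΔσ F (F (fromℕ p)) r H ×
      IsShelling r H ×
      (∀ i j → F i ∪ F (fromℕ p) ≡ ⊤ →
        H j ≡ inside ∷ (F i ∩ F (fromℕ p)) →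
        ∀ G̃ G → IsG H j G̃ → IsG F i G →
        G̃ ≡ outside ∷ (G ∩ F (fromℕ p)))
lemma4p8 n p F facets shelling small =
  _ , H , (H-facet , H-surjective , H-injective) , H-shelling , IsG-Cospanning
  where
  open Δσ-Shelling F facets shelling small
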